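{- Let $\lambda\neq()$ be a nonempty partition. Then $\lambda$ is a $\mathcal{P}$-position of LCTR under misère play if and only if $\lambda$ is a $\mathcal{P}$-position of Downright under normal play.
   Context: For a partition $\mu=(\mu_1,\dots,\mu_s)$ and nonnegative integers $i,j$, $\mu[i,j]$ is $(\mu_{i+1}-j,\mu_{i+2}-j,\dots)$ with nonpositive entries removed, if $i<s$ and $j<\mu_{i+1}$; otherwise $\mu[i,j]=()$. LCTR: positions are partitions; from a nonempty $\mu$ one moves to $\mu[1,0]$ or $\mu[0,1]$; $()$ is the unique terminal position. Downright: positions are nonempty partitions; from $\mu=(\mu_1,\dots,\mu_s)$ one may move to $\mu[1,0]$ if $s>1$ and to $\mu[0,1]$ if $\mu_1>1$. Under normal play a player unable to move loses; under misère play a player unable to move wins. $\mathcal{P}$-positions are defined recursively: terminal positions are $\mathcal{P}$ under normal play and $\mathcal{N}$ under misère play; a non-terminal position is $\mathcal{P}$ iff none of its moves leads to a $\mathcal{P}$-position (otherwise it is $\mathcal{N}$). -}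

module Defs where

open import Data.Nat using (ℕ; zero; suc; _∸_; _≤_; _<_; _≥_)
open import Data.Nat.Properties using (_<?_)
open import Data.List using (List; []; _∷_; drop; map; filter; length; head)
open import Data.List.Relation.Unary.AllPairs using (AllPairs)
open import Data.List.Relation.Unary.All using (All)
open import Data.Product using (_×_)
open import Relation.Nullary using (yes; no; ¬_)
open import Relation.Binary.PropositionalEquality using (_≡_)

IsPartition : List ℕ → Set
IsPartition μ = AllPairs (λ a b → b ≤ a) μ × All (λ a → 1 ≤ a) μ

_[_,_] : List ℕ → ℕ → ℕ → List ℕ
μ [ i , j ] with drop i μ
... | [] = []
... | (a ∷ rest) with j <? a
...   | yes _ = filter (λ x → 0 <? x) (map (λ x → x ∸ j) (a ∷ rest))
...   | no  _ = []

-- LCTR under misère play: () is terminal (hence an N-position under misère);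
-- a nonempty μ has moves to μ[1,0] and μ[0,1].
mutual
  data LCTR-misère-P : List ℕ → Set where
    lctrP : ∀ {a μ} →
            LCTR-misère-N ((a ∷ μ) [ 1 , 0 ]) →
            LCTR-misère-N ((a ∷ μ) [ 0 , 1 ]) →
            LCTR-misère-P (a ∷ μ)

  data LCTR-misère-N : List ℕ → Set where
    lctrTerminal : LCTR-misère-N []
    lctrN₁ : ∀ {a μ} → LCTR-misère-P ((a ∷ μ) [ 1 , 0 ]) → LCTR-misère-N (a ∷ μ)
    lctrN₂ : ∀ {a μ} → LCTR-misère-P ((a ∷ μ) [ 0 , 1 ]) → LCTR-misère-N (a ∷ μ)

-- Downright under normal play: positions are nonempty partitions
-- μ = (μ_1,…,μ_s); move to μ[1,0] allowed iff s > 1, to μ[0,1] iff μ_1 > 1.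
-- A position is P iff every available move leads to an N-position
-- (in particular a terminal position is P); N iff some move leads to P.
mutual
  data Downright-normal-P : List ℕ → Set where
    drP : ∀ {a μ} →
          (1 < length (a ∷ μ) → Downright-normal-N ((a ∷ μ) [ 1 , 0 ])) →
          (1 < a → Downright-normal-N ((a ∷ μ) [ 0 , 1 ])) →
          Downright-normal-P (a ∷ μ)

  data Downright-normal-N : List ℕ → Set where
    drN₁ : ∀ {a μ} → 1 < length (a ∷ μ) →
           Downright-normal-P ((a ∷ μ) [ 1 , 0 ]) → Downright-normal-N (a ∷ μ)
    drN₂ : ∀ {a μ} → 1 < a →
           Downright-normal-P ((a ∷ μ) [ 0 , 1 ]) → Downright-normal-N (a ∷ μ)

-- A move of misère LCTR into () hands the opponent the win, so it is never worth
-- making; removing exactly those moves leaves Downright, whose moves are the LCTR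
-- moves into a nonempty partition.
module Submission where

open import Defs
open import Data.Nat using (ℕ; zero; suc; _∸_; _≤_; _<_; z≤n; s≤s)
open import Data.Nat.Properties using (_<?_)
open import Data.List using (List; []; _∷_; drop; length; map)
open import Data.List.Relation.Unary.All using (All; []; _∷_)
open import Data.List.Relation.Unary.All.Properties using (all-filter)
open import Data.Product using (proj₂)
open import Relation.Binary.PropositionalEquality using (_≡_; _≢_; refl)
open import Relation.Nullary using (¬_; yes; no; contradiction)
open import Function.Bundles using (_⇔_; mk⇔; Equivalence)

PositiveEntries : List ℕ → Set
PositiveEntries = All (1 ≤_)

[,]-positiveEntries : ∀ μ i j → PositiveEntries (μ [ i , j ])
[,]-positiveEntries μ i j with drop i μ
... | [] = []
... | a ∷ rest with j <? a
...   | yes _ = all-filter (0 <?_) (map (_∸ j) (a ∷ rest))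
...   | no  _ = []

-- Positivity of the second part is what makes μ[1,0] nonempty when s > 1.
[1,0]≢[]⇔1<length : ∀ {a μ} → PositiveEntries (a ∷ μ) →
                    1 < length (a ∷ μ) ⇔ (a ∷ μ) [ 1 , 0 ] ≢ []
[1,0]≢[]⇔1<length {a} {μ} (_ ∷ pos) = mk⇔ (to μ pos) (from μ)
  where
  to : ∀ μ → PositiveEntries μ → 1 < length (a ∷ μ) → (a ∷ μ) [ 1 , 0 ] ≢ []
  to []          _        (s≤s ())
  to (zero ∷ _)  (() ∷ _) _
  to (suc _ ∷ _) _        _ ()

  from : ∀ μ → (a ∷ μ) [ 1 , 0 ] ≢ [] → 1 < length (a ∷ μ)
  from []      ne = contradiction refl ne
  from (_ ∷ _) _  = s≤s (s≤s z≤n)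

[0,1]≢[]⇔1<head : ∀ {a μ} → 1 < a ⇔ (a ∷ μ) [ 0 , 1 ] ≢ []
[0,1]≢[]⇔1<head {a} {μ} = mk⇔ (to a) (from a)
  where
  to : ∀ a → 1 < a → (a ∷ μ) [ 0 , 1 ] ≢ []
  to (suc zero)    (s≤s ())
  to (suc (suc _)) _ ()

  from : ∀ a → (a ∷ μ) [ 0 , 1 ] ≢ [] → 1 < a
  from zero          ne = contradiction refl ne
  from (suc zero)    ne = contradiction refl ne
  from (suc (suc _)) _  = s≤s (s≤s z≤n)

[]-or-nonempty : (X : List ℕ → Set) → X [] → ∀ {ν} → (ν ≢ [] → X ν) → X ν
[]-or-nonempty X x[] {[]}    _  = x[]
[]-or-nonempty X _   {_ ∷ _} xν = xν (λ ())

misère-P⇒nonempty : ∀ {ν} → LCTR-misère-P ν → ν ≢ []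
misère-P⇒nonempty (lctrP _ _) ()

normal-P⇒nonempty : ∀ {ν} → Downright-normal-P ν → ν ≢ []
normal-P⇒nonempty (drP _ _) ()

mutual
  misère-P⇒normal-P : ∀ {ν} → PositiveEntries ν →
                      LCTR-misère-P ν → Downright-normal-P ν
  misère-P⇒normal-P {a ∷ μ} pos (lctrP n₁ n₂) = drP
    (λ s>1 → misère-N⇒normal-N ([,]-positiveEntries (a ∷ μ) 1 0)
               (Equivalence.to ([1,0]≢[]⇔1<length pos) s>1) n₁)
    (λ a>1 → misère-N⇒normal-N ([,]-positiveEntries (a ∷ μ) 0 1)
               (Equivalence.to [0,1]≢[]⇔1<head a>1) n₂)

  misère-N⇒normal-N : ∀ {ν} → PositiveEntries ν → ν ≢ [] →
                      LCTR-misère-N ν → Downright-normal-N ν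
  misère-N⇒normal-N _ ne lctrTerminal = contradiction refl ne
  misère-N⇒normal-N {a ∷ μ} pos _ (lctrN₁ p) = drN₁
    (Equivalence.from ([1,0]≢[]⇔1<length pos) (misère-P⇒nonempty p))
    (misère-P⇒normal-P ([,]-positiveEntries (a ∷ μ) 1 0) p)
  misère-N⇒normal-N {a ∷ μ} pos _ (lctrN₂ p) = drN₂
    (Equivalence.from [0,1]≢[]⇔1<head (misère-P⇒nonempty p))
    (misère-P⇒normal-P ([,]-positiveEntries (a ∷ μ) 0 1) p)

  -- An unavailable Downright move is an LCTR move into (), which is misère-N.
  normal-P⇒misère-P : ∀ {ν} → PositiveEntries ν →
                      Downright-normal-P ν → LCTR-misère-P ν
  normal-P⇒misère-P {a ∷ μ} pos (drP d₁ d₂) = lctrP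
    ([]-or-nonempty LCTR-misère-N lctrTerminal λ ne →
       normal-N⇒misère-N ([,]-positiveEntries (a ∷ μ) 1 0)
         (d₁ (Equivalence.from ([1,0]≢[]⇔1<length pos) ne)))
    ([]-or-nonempty LCTR-misère-N lctrTerminal λ ne →
       normal-N⇒misère-N ([,]-positiveEntries (a ∷ μ) 0 1)
         (d₂ (Equivalence.from [0,1]≢[]⇔1<head ne)))

  normal-N⇒misère-N : ∀ {ν} → PositiveEntries ν →
                      Downright-normal-N ν → LCTR-misère-N ν
  normal-N⇒misère-N {a ∷ μ} _ (drN₁ _ p) =
    lctrN₁ (normal-P⇒misère-P ([,]-positiveEntries (a ∷ μ) 1 0) p)
  normal-N⇒misère-N {a ∷ μ} _ (drN₂ _ p) =
    lctrN₂ (normal-P⇒misère-P ([,]-positiveEntries (a ∷ μ) 0 1) p)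

lemma4p1 : (λ' : List ℕ) → IsPartition λ' → ¬ (λ' ≡ []) →
    (LCTR-misère-P λ' ⇔ Downright-normal-P λ')
lemma4p1 λ' partition _ =
  mk⇔ (misère-P⇒normal-P positive) (normal-P⇒misère-P positive)
  where
  positive : PositiveEntries λ'
  positive = proj₂ partition
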